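{- Let $d\ge1$, let $A,B\subseteq\{0,1\}^d$ be finite nonempty sets with $|A|\le|B|$, let $P_2'=P_2$ and $P_1'=3^{|P_2'|}P_13^{|P_2'|}$ with $P_1,P_2$ as in the context, and $Y=2|P_2'|+|A|\cdot E_u$. If there exist $a\in A$, $b\in B$ with $a\cdot b=0$, then $\mathrm{EDIT}(P_1',P_2')\le Y-(E_u-E_s)$.
   Context: $\mathrm{EDIT}(x,y)$ is the edit distance (minimum number of single-symbol insertions, deletions, substitutions transforming $x$ into $y$). $c^i$ denotes symbol $c$ repeated $i$ times; $\bigcirc$ denotes concatenation; $|s|$ is length; $a\cdot b=\sum_j a_jb_j$. Construction: $l_0=1000d$, $l_1=(1000d)^2$, $l_2=(1000d)^3$. $\mathrm{CG}_1(0)=0^{l_1}0^{l_0}1^{l_0}1^{l_0}1^{l_0}0^{l_1}$, $\mathrm{CG}_1(1)=0^{l_1}0^{l_0}0^{l_0}0^{l_0}1^{l_0}0^{l_1}$, $\mathrm{CG}_2(0)=0^{l_1}0^{l_0}0^{l_0}1^{l_0}1^{l_0}0^{l_1}$, $\mathrm{CG}_2(1)=0^{l_1}1^{l_0}1^{l_0}1^{l_0}1^{l_0}0^{l_1}$, $g=0^{l_1/2-1}1\,0^{l_1/2}0^{l_0}1^{l_0}1^{l_0}1^{l_0}0^{l_1}$. For $a,b\in\{0,1\}^d$: $L=\bigcirc_{i=1}^d g$, $R=\bigcirc_{i=1}^d\mathrm{CG}_1(a_i)$, $D=\bigcirc_{i=1}^d\mathrm{CG}_2(b_i)$, $\mathrm{AG}_1(a)=0^{l_2}L1^{l_2}R0^{l_2}$,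 $\mathrm{AG}_2(b)=1^{l_2}D1^{l_2}$. $l=d(4l_0+2l_1)$, $E_s=2l_2+l+dl_0$, $E_u=l+2l_2+dl_0+d$. $t=\max(|\mathrm{AG}_1(a)|,|\mathrm{AG}_2(b)|)$, $T=1000d\cdot t$, $\mathrm{AG}_k'(v)=2^T\mathrm{AG}_k(v)2^T$, $f$ the all-ones vector. $P_1=\bigcirc_{a\in A}\mathrm{AG}_1'(a)$, $P_2=\left(\bigcirc_{i=1}^{|A|-1}\mathrm{AG}_2'(f)\right)\left(\bigcirc_{b\in B}\mathrm{AG}_2'(b)\right)\left(\bigcirc_{i=1}^{|A|-1}\mathrm{AG}_2'(f)\right)$ (any fixed orders of $A$, $B$). -}

module Defs where

open import Data.Nat using (ℕ; zero; suc; _+_; _*_; _∸_; _^_; _≤_; _⊔_)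
open import Data.Nat.DivMod using (_/_)
open import Data.Bool using (Bool; true; false; _∧_)
open import Data.List using (List; []; _∷_; _++_; replicate; length; concat; map; foldr)
open import Data.Vec using (Vec; toList; zipWith)
import Data.Vec as V
open import Data.Product using (Σ; _×_; ∃)

-- Strings over the alphabet {0,1,2,3}, symbols represented as natural numbers.
Str : Set
Str = List ℕ

rep : ℕ → ℕ → Str
rep c i = replicate i c

data EditStep : Str → Str → Set where
  ins : (u w : Str) (c : ℕ) → EditStep (u ++ w) (u ++ c ∷ w)
  del : (u w : Str) (c : ℕ) → EditStep (u ++ c ∷ w) (u ++ w)
  sub : (u w : Str) (c c' : ℕ) → EditStep (u ++ c ∷ w) (u ++ c' ∷ w)

data EditSteps : ℕ → Str → Str → Set where
  done : ∀ {x} → EditSteps 0 x x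
  step : ∀ {k x y z} → EditStep x y → EditSteps k y z → EditSteps (suc k) x z

-- EDIT(x,y) ≤ n : the minimum number of operations is at most n,
-- i.e. some transformation uses at most n operations.
EDIT≤ : Str → Str → ℕ → Set
EDIT≤ x y n = ∃ λ k → k ≤ n × EditSteps k x y

l0 l1 l2 : ℕ → ℕ
l0 d = 1000 * d
l1 d = (1000 * d) ^ 2
l2 d = (1000 * d) ^ 3

CG₁ : ℕ → Bool → Str
CG₁ d false = rep 0 (l1 d) ++ rep 0 (l0 d) ++ rep 1 (l0 d) ++ rep 1 (l0 d) ++ rep 1 (l0 d) ++ rep 0 (l1 d)
CG₁ d true  = rep 0 (l1 d) ++ rep 0 (l0 d) ++ rep 0 (l0 d) ++ rep 0 (l0 d) ++ rep 1 (l0 d) ++ rep 0 (l1 d)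

CG₂ : ℕ → Bool → Str
CG₂ d false = rep 0 (l1 d) ++ rep 0 (l0 d) ++ rep 0 (l0 d) ++ rep 1 (l0 d) ++ rep 1 (l0 d) ++ rep 0 (l1 d)
CG₂ d true  = rep 0 (l1 d) ++ rep 1 (l0 d) ++ rep 1 (l0 d) ++ rep 1 (l0 d) ++ rep 1 (l0 d) ++ rep 0 (l1 d)

g : ℕ → Str
g d = rep 0 (l1 d / 2 ∸ 1) ++ 1 ∷ rep 0 (l1 d / 2) ++ rep 0 (l0 d) ++ rep 1 (l0 d) ++ rep 1 (l0 d) ++ rep 1 (l0 d) ++ rep 0 (l1 d)

Lg : ℕ → Str
Lg d = concat (replicate d (g d))

Rg : ∀ {d} → Vec Bool d → Str
Rg {d} a = concat (map (CG₁ d) (toList a))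

Dg : ∀ {d} → Vec Bool d → Str
Dg {d} b = concat (map (CG₂ d) (toList b))

AG₁ : ∀ {d} → Vec Bool d → Str
AG₁ {d} a = rep 0 (l2 d) ++ Lg d ++ rep 1 (l2 d) ++ Rg a ++ rep 0 (l2 d)

AG₂ : ∀ {d} → Vec Bool d → Str
AG₂ {d} b = rep 1 (l2 d) ++ Dg b ++ rep 1 (l2 d)

lTot Es Eu : ℕ → ℕ
lTot d = d * (4 * l0 d + 2 * l1 d)
Es d = 2 * l2 d + lTot d + d * l0 d
Eu d = lTot d + 2 * l2 d + d * l0 d + d

-- t = max(|AG₁(a)|, |AG₂(b)|); these lengths do not depend on the
-- vectors, we evaluate them at the vector the gadget is built from.
tLen : ∀ {d} → Vec Bool d → ℕ
tLen v = length (AG₁ v) ⊔ length (AG₂ v)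

TLen : ∀ {d} → Vec Bool d → ℕ
TLen {d} v = 1000 * d * tLen v

AG₁' : ∀ {d} → Vec Bool d → Str
AG₁' v = rep 2 (TLen v) ++ AG₁ v ++ rep 2 (TLen v)

AG₂' : ∀ {d} → Vec Bool d → Str
AG₂' v = rep 2 (TLen v) ++ AG₂ v ++ rep 2 (TLen v)

fVec : ∀ d → Vec Bool d
fVec d = V.replicate d true

-- A, B given as lists (the chosen fixed order)
P₁ : ∀ {d} → List (Vec Bool d) → Str
P₁ A = concat (map AG₁' A)

P₂ : ∀ {d} → List (Vec Bool d) → List (Vec Bool d) → Str
P₂ {d} A B = concat (replicate (length A ∸ 1) (AG₂' (fVec d)))
          ++ concat (map AG₂' B)
          ++ concat (replicate (length A ∸ 1) (AG₂' (fVec d)))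

bit : Bool → ℕ
bit false = 0
bit true  = 1

dot : ∀ {d} → Vec Bool d → Vec Bool d → ℕ
dot a b = V.foldr _ _+_ 0 (zipWith (λ x y → bit x * bit y) a b)

module Submission where

-- The proof exhibits an explicit edit script; only upper bounds on costs are needed.
-- 1. Edit calculus: bounds EDIT(x,y) ≤ n compose along concatenation and along
--    sequential composition; a string of length N can be turned into any string of
--    length ≤ N with N operations (substitute, then delete the rest).
-- 2. Gadget costs: each block g of L is CG₁(0) with one bit flipped, and blocks
--    CG₁(x), CG₂(y) differ in l₀ symbols when x·y = 0.  Hence AG₁(a) → AG₂(v) costs E_u
--    for every v (turn 0^{l₂} into 1^{l₂}, L into D, delete R 0^{l₂}), and E_s if
--    a·v = 0 (delete 0^{l₂} L, turn R into D and 0^{l₂} into 1^{l₂}); E_u = E_s + d.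
--    Padding with 2^T preserves these bounds, since T does not depend on the vector.
-- 3. Alignment: writing A = A₁ a A₂, the padded list f^{|A|−1} B f^{|A|−1} contains b
--    with at least |A₁| gadgets to its left and |A₂| to its right.  P₁ is edited onto
--    this window (a onto b at cost E_s, the others at cost E_u) and each 3-block of
--    length |P₂'| is rewritten into the leftover part of P₂' on its side.
-- Adding up gives 2|P₂'| + |A|·E_u − d, which is exactly Y − (E_u − E_s).

open import Defs
open import Data.Nat using (ℕ; zero; suc; _+_; _*_; _∸_; _≤_; _⊔_; z≤n; s≤s)
open import Data.Nat.Properties
  using (≤-trans; ≤-reflexive; +-mono-≤; *-mono-≤; m∸[m∸n]≡n; m≤n⇒m⊓n≡m; m≤m+n; m≤n+m; +-suc; m+n∸m≡n; m+n∸n≡m; m+n≡0⇒m≡0; m+n≡0⇒n≡0; suc-injective)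
open import Data.Nat.DivMod using (_/_; m*n/n≡m)
open import Data.Nat.Tactic.RingSolver using (solve-∀)
open import Data.Bool using (Bool; true; false)
open import Data.List using (List; []; _∷_; length; _++_; replicate; concat; map; take; drop)
open import Data.List.Properties
  using (++-assoc; ++-identityʳ; length-++; length-++-≤ˡ; length-++-≤ʳ; length-replicate; length-take; length-drop; take++drop≡id; map-++; map-replicate; concat-++)
open import Data.List.Membership.Propositional using (_∈_)
open import Data.List.Membership.Propositional.Properties using (∈-∃++)
open import Data.List.Relation.Unary.Unique.Propositional using (Unique)
open import Data.Vec using (Vec; toList) renaming ([] to []ᵥ; _∷_ to _∷ᵥ_)
open import Data.Vec.Properties using (length-toList)
open import Data.Product using (∃₂; _×_; _,_)
open import Relation.Binary.PropositionalEquality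
  using (_≡_; _≢_; refl; sym; trans; cong; cong₂; subst; subst₂; module ≡-Reasoning)

-- Edit calculus

step-++ʳ : ∀ {x y} z → EditStep x y → EditStep (x ++ z) (y ++ z)
step-++ʳ z (ins u w c) =
  subst₂ EditStep (sym (++-assoc u w z)) (sym (++-assoc u (c ∷ w) z)) (ins u (w ++ z) c)
step-++ʳ z (del u w c) =
  subst₂ EditStep (sym (++-assoc u (c ∷ w) z)) (sym (++-assoc u w z)) (del u (w ++ z) c)
step-++ʳ z (sub u w c c') =
  subst₂ EditStep (sym (++-assoc u (c ∷ w) z)) (sym (++-assoc u (c' ∷ w) z)) (sub u (w ++ z) c c')

step-++ˡ : ∀ {x y} z → EditStep x y → EditStep (z ++ x) (z ++ y)
step-++ˡ z (ins u w c) =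
  subst₂ EditStep (++-assoc z u w) (++-assoc z u (c ∷ w)) (ins (z ++ u) w c)
step-++ˡ z (del u w c) =
  subst₂ EditStep (++-assoc z u (c ∷ w)) (++-assoc z u w) (del (z ++ u) w c)
step-++ˡ z (sub u w c c') =
  subst₂ EditStep (++-assoc z u (c ∷ w)) (++-assoc z u (c' ∷ w)) (sub (z ++ u) w c c')

steps-++ʳ : ∀ {k x y} z → EditSteps k x y → EditSteps k (x ++ z) (y ++ z)
steps-++ʳ z done        = done
steps-++ʳ z (step s ss) = step (step-++ʳ z s) (steps-++ʳ z ss)

steps-++ˡ : ∀ {k x y} z → EditSteps k x y → EditSteps k (z ++ x) (z ++ y)
steps-++ˡ z done        = done
steps-++ˡ z (step s ss) = step (step-++ˡ z s) (steps-++ˡ z ss)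

steps-trans : ∀ {k m x y z} → EditSteps k x y → EditSteps m y z → EditSteps (k + m) x z
steps-trans done        t = t
steps-trans (step s ss) t = step s (steps-trans ss t)

infixr 4 _⨾_
_⨾_ : ∀ {x y z n m} → EDIT≤ x y n → EDIT≤ y z m → EDIT≤ x z (n + m)
(k , k≤n , s) ⨾ (k' , k'≤m , s') = k + k' , +-mono-≤ k≤n k'≤m , steps-trans s s'

infixr 5 _⊕_
_⊕_ : ∀ {x y x' y' n m} → EDIT≤ x y n → EDIT≤ x' y' m → EDIT≤ (x ++ x') (y ++ y') (n + m)
_⊕_ {y = y} {x' = x'} (k , k≤n , s) (k' , k'≤m , s') =
  k + k' , +-mono-≤ k≤n k'≤m , steps-trans (steps-++ʳ x' s) (steps-++ˡ y s')

pre : ∀ {x y n} z → EDIT≤ x y n → EDIT≤ (z ++ x) (z ++ y) n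
pre z (k , p , s) = k , p , steps-++ˡ z s

post : ∀ {x y n} z → EDIT≤ x y n → EDIT≤ (x ++ z) (y ++ z) n
post z (k , p , s) = k , p , steps-++ʳ z s

edit-refl : ∀ {x} → EDIT≤ x x 0
edit-refl = 0 , z≤n , done

recost : ∀ {x y n m} → n ≡ m → EDIT≤ x y n → EDIT≤ x y m
recost refl e = e

cast : ∀ {x x' y y' n} → x ≡ x' → y ≡ y' → EDIT≤ x y n → EDIT≤ x' y' n
cast refl refl e = e

substitute : ∀ u w c c' → EDIT≤ (u ++ c ∷ w) (u ++ c' ∷ w) 1
substitute u w c c' = 1 , s≤s z≤n , step (sub u w c c') done

delete : ∀ u w c → EDIT≤ (u ++ c ∷ w) (u ++ w) 1
delete u w c = 1 , s≤s z≤n , step (del u w c) done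

delete-all : ∀ x → EDIT≤ x [] (length x)
delete-all []      = edit-refl
delete-all (c ∷ x) = delete [] x c ⨾ delete-all x

substitute-run : ∀ c c' n → EDIT≤ (rep c n) (rep c' n) n
substitute-run c c' zero    = edit-refl
substitute-run c c' (suc n) = substitute [] [] c c' ⊕ substitute-run c c' n

shrink : ∀ x y → length y ≤ length x → EDIT≤ x y (length x)
shrink []      []       _         = edit-refl
shrink (c ∷ x) []       _         = delete-all (c ∷ x)
shrink (c ∷ x) (c' ∷ y) (s≤s y≤x) = substitute [] [] c c' ⊕ shrink x y y≤x

shrink-run : ∀ c N y → length y ≤ N → EDIT≤ (rep c N) y N
shrink-run c N y y≤N =
  recost (length-replicate N) (shrink (rep c N) y (≤-trans y≤N (≤-reflexive (sym (length-replicate N)))))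

length-run++ : ∀ c n s → length (rep c n ++ s) ≡ n + length s
length-run++ c n s = trans (length-++ (rep c n)) (cong (_+ length s) (length-replicate n))

length-substitute : ∀ (u w : Str) c c' → length (u ++ c ∷ w) ≡ length (u ++ c' ∷ w)
length-substitute u w c c' = trans (length-++ u) (sym (length-++ u))

length-concat-map : ∀ {X : Set} (h : X → Str) {K} → (∀ x → length (h x) ≡ K) →
                    ∀ xs → length (concat (map h xs)) ≡ length xs * K
length-concat-map h hK []       = refl
length-concat-map h hK (x ∷ xs) =
  trans (length-++ (h x)) (cong₂ _+_ (hK x) (length-concat-map h hK xs))

length-concat-replicate : ∀ n (s : Str) → length (concat (replicate n s)) ≡ n * length s
length-concat-replicate zero    s = refl
length-concat-replicate (suc n) s = trans (length-++ s) (cong (length s +_) (length-concat-replicate n s))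

concat-map-++ : ∀ {X : Set} (h : X → Str) xs ys →
                concat (map h (xs ++ ys)) ≡ concat (map h xs) ++ concat (map h ys)
concat-map-++ h xs ys = trans (cong concat (map-++ h xs ys)) (sym (concat-++ (map h xs) (map h ys)))

-- l₁ is even and positive, so it splits as (l₁/2 − 1) + 1 + l₁/2.
l1-split : ∀ d → 1 ≤ d → l1 d ≡ (l1 d / 2 ∸ 1) + suc (l1 d / 2)
l1-split d 1≤d = begin
    l1 d                                   ≡⟨ l1≡q*2 d ⟩
    q * 2                                  ≡⟨ halves q q≥1 ⟩
    (q ∸ 1) + suc q                        ≡⟨ cong (λ t → (t ∸ 1) + suc t) (sym l1/2≡q) ⟩
    (l1 d / 2 ∸ 1) + suc (l1 d / 2)        ∎
  where
  open ≡-Reasoning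
  q : ℕ
  q = 500 * (d * (1000 * d))
  l1≡q*2 : ∀ n → (1000 * n) * ((1000 * n) * 1) ≡ 500 * (n * (1000 * n)) * 2
  l1≡q*2 = solve-∀
  q≥1 : 1 ≤ q
  q≥1 = *-mono-≤ {1} {500} (s≤s z≤n) (*-mono-≤ 1≤d (*-mono-≤ {1} {1000} (s≤s z≤n) 1≤d))
  l1/2≡q : l1 d / 2 ≡ q
  l1/2≡q = trans (cong (_/ 2) (l1≡q*2 d)) (m*n/n≡m q 2)
  halves : ∀ q → 1 ≤ q → q * 2 ≡ (q ∸ 1) + suc q
  halves (suc q) _ = double q
    where
    double : ∀ q → suc q * 2 ≡ q + suc (suc q)
    double = solve-∀

Eu≡Es+d : ∀ d → Eu d ≡ Es d + d
Eu≡Es+d d = reorder (lTot d) (l2 d) (d * l0 d) d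
  where
  reorder : ∀ l a m d → l + 2 * a + m + d ≡ 2 * a + l + m + d
  reorder = solve-∀

-- Coordinate gadgets and their costs

module _ (d : ℕ) where
  private
    L0 L1 L2 : ℕ
    L0 = l0 d
    L1 = l1 d
    L2 = l2 d

  block : (x₁ x₂ x₃ x₄ : ℕ) → Str
  block x₁ x₂ x₃ x₄ = rep 0 L1 ++ rep x₁ L0 ++ rep x₂ L0 ++ rep x₃ L0 ++ rep x₄ L0 ++ rep 0 L1

  blockLen : ℕ
  blockLen = 4 * L0 + 2 * L1

  length-block : ∀ x₁ x₂ x₃ x₄ → length (block x₁ x₂ x₃ x₄) ≡ blockLen
  length-block x₁ x₂ x₃ x₄ = begin
      length (block x₁ x₂ x₃ x₄)                ≡⟨ run-lengths ⟩
      L1 + (L0 + (L0 + (L0 + (L0 + L1))))       ≡⟨ collect L0 L1 ⟩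
      blockLen                                  ∎
    where
    open ≡-Reasoning
    run-lengths : length (block x₁ x₂ x₃ x₄) ≡ L1 + (L0 + (L0 + (L0 + (L0 + L1))))
    run-lengths =
      trans (length-run++ 0 L1 _) (cong (L1 +_)
      (trans (length-run++ x₁ L0 _) (cong (L0 +_)
      (trans (length-run++ x₂ L0 _) (cong (L0 +_)
      (trans (length-run++ x₃ L0 _) (cong (L0 +_)
      (trans (length-run++ x₄ L0 _) (cong (L0 +_) (length-replicate L1))))))))))
    collect : ∀ a b → b + (a + (a + (a + (a + b)))) ≡ 4 * a + 2 * b
    collect = solve-∀

  length-CG₁ : ∀ x → length (CG₁ d x) ≡ blockLen
  length-CG₁ false = length-block 0 1 1 1
  length-CG₁ true  = length-block 0 0 0 1

  length-CG₂ : ∀ x → length (CG₂ d x) ≡ blockLen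
  length-CG₂ false = length-block 0 0 1 1
  length-CG₂ true  = length-block 1 1 1 1

  -- Gadgets of orthogonal bits differ in exactly one l₀-run.
  CG-orthogonal : ∀ x y → bit x * bit y ≡ 0 → EDIT≤ (CG₁ d x) (CG₂ d y) L0
  CG-orthogonal false false _ =
    pre (rep 0 L1) (pre (rep 0 L0) (post (rep 1 L0 ++ rep 1 L0 ++ rep 0 L1) (substitute-run 1 0 L0)))
  CG-orthogonal false true  _ =
    pre (rep 0 L1) (post (rep 1 L0 ++ rep 1 L0 ++ rep 1 L0 ++ rep 0 L1) (substitute-run 0 1 L0))
  CG-orthogonal true  false _ =
    pre (rep 0 L1) (pre (rep 0 L0) (pre (rep 0 L0)
      (post (rep 1 L0 ++ rep 0 L1) (substitute-run 0 1 L0))))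
  CG-orthogonal true  true  ()

  R→D : ∀ {n} (a b : Vec Bool n) → dot a b ≡ 0 →
        EDIT≤ (concat (map (CG₁ d) (toList a))) (concat (map (CG₂ d) (toList b))) (n * L0)
  R→D []ᵥ       []ᵥ       _   = edit-refl
  R→D (x ∷ᵥ a) (y ∷ᵥ b) a⊥b =
    CG-orthogonal x y (m+n≡0⇒m≡0 (bit x * bit y) a⊥b) ⊕ R→D a b (m+n≡0⇒n≡0 (bit x * bit y) a⊥b)

  length-Rg : ∀ (a : Vec Bool d) → length (Rg a) ≡ lTot d
  length-Rg a = trans (length-concat-map (CG₁ d) length-CG₁ (toList a)) (cong (_* blockLen) (length-toList a))

  length-Dg : ∀ (b : Vec Bool d) → length (Dg b) ≡ lTot d
  length-Dg b = trans (length-concat-map (CG₂ d) length-CG₂ (toList b)) (cong (_* blockLen) (length-toList b))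

  -- Gadget lengths do not depend on the vector, hence neither does the padding length T.
  length-AG₁ : ∀ (a : Vec Bool d) → length (AG₁ a) ≡ L2 + (length (Lg d) + (L2 + (lTot d + L2)))
  length-AG₁ a =
    trans (length-run++ 0 L2 _) (cong (L2 +_)
    (trans (length-++ (Lg d)) (cong (length (Lg d) +_)
    (trans (length-run++ 1 L2 _) (cong (L2 +_)
    (trans (length-++ (Rg a)) (cong₂ _+_ (length-Rg a) (length-replicate L2))))))))

  length-AG₂ : ∀ (b : Vec Bool d) → length (AG₂ b) ≡ L2 + (lTot d + L2)
  length-AG₂ b =
    trans (length-run++ 1 L2 _) (cong (L2 +_)
    (trans (length-++ (Dg b)) (cong₂ _+_ (length-Dg b) (length-replicate L2))))

  TLen-indep : ∀ (a v : Vec Bool d) → TLen a ≡ TLen v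
  TLen-indep a v = cong (λ t → 1000 * d * t)
    (cong₂ _⊔_ (trans (length-AG₁ a) (sym (length-AG₁ v))) (trans (length-AG₂ a) (sym (length-AG₂ v))))

  padded : ∀ {c} (a v : Vec Bool d) → EDIT≤ (AG₁ a) (AG₂ v) c → EDIT≤ (AG₁' a) (AG₂' v) c
  padded a v e = cast refl (cong (λ t → rep 2 t ++ AG₂ v ++ rep 2 t) (TLen-indep a v))
    (pre (rep 2 (TLen a)) (post (rep 2 (TLen a)) e))

  module _ (1≤d : 1 ≤ d) where
    private
      h : ℕ
      h = l1 d / 2
      rest : Str
      rest = rep 0 L0 ++ rep 1 L0 ++ rep 1 L0 ++ rep 1 L0 ++ rep 0 L1

    -- g = 0^{h−1} 1 0^{h} rest, while CG₁(0) = 0^{h−1} 0 0^{h} rest.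
    CG₁-false-split : CG₁ d false ≡ rep 0 (h ∸ 1) ++ 0 ∷ rep 0 h ++ rest
    CG₁-false-split = begin
        rep 0 L1 ++ rest                             ≡⟨ cong (λ n → rep 0 n ++ rest) (l1-split d 1≤d) ⟩
        rep 0 ((h ∸ 1) + suc h) ++ rest              ≡⟨ cong (_++ rest) (replicate-+ (h ∸ 1) (suc h)) ⟩
        (rep 0 (h ∸ 1) ++ 0 ∷ rep 0 h) ++ rest       ≡⟨ ++-assoc (rep 0 (h ∸ 1)) (0 ∷ rep 0 h) rest ⟩
        rep 0 (h ∸ 1) ++ 0 ∷ rep 0 h ++ rest         ∎
      where
      open ≡-Reasoning
      replicate-+ : ∀ m n → rep 0 (m + n) ≡ rep 0 m ++ rep 0 n
      replicate-+ zero    n = refl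
      replicate-+ (suc m) n = cong (0 ∷_) (replicate-+ m n)

    g→CG₁-false : EDIT≤ (g d) (CG₁ d false) 1
    g→CG₁-false = cast refl (sym CG₁-false-split) (substitute (rep 0 (h ∸ 1)) (rep 0 h ++ rest) 1 0)

    length-g : length (g d) ≡ blockLen
    length-g = begin
        length (g d)                                       ≡⟨ length-substitute (rep 0 (h ∸ 1)) (rep 0 h ++ rest) 1 0 ⟩
        length (rep 0 (h ∸ 1) ++ 0 ∷ rep 0 h ++ rest)      ≡⟨ cong length (sym CG₁-false-split) ⟩
        length (CG₁ d false)                               ≡⟨ length-CG₁ false ⟩
        blockLen                                           ∎
      where open ≡-Reasoning

    length-Lg : length (Lg d) ≡ lTot d
    length-Lg = trans (length-concat-replicate d (g d)) (cong (d *_) length-g)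

    -- L → D(v) blockwise, through CG₁(0) which is orthogonal to everything.
    L→D : ∀ {n} (v : Vec Bool n) →
          EDIT≤ (concat (replicate n (g d))) (concat (map (CG₂ d) (toList v))) (n * suc L0)
    L→D []ᵥ      = edit-refl
    L→D (y ∷ᵥ v) = (g→CG₁-false ⨾ CG-orthogonal false y refl) ⊕ L→D v

    -- Orthogonal pair: delete 0^{l₂} L, keep 1^{l₂}, R → D, 0^{l₂} → 1^{l₂}.
    AG-orthogonal : ∀ (a v : Vec Bool d) → dot a v ≡ 0 → EDIT≤ (AG₁ a) (AG₂ v) (Es d)
    AG-orthogonal a v a⊥v = cast (++-assoc (rep 0 L2) (Lg d) _) refl
      (recost cost (delete-all (rep 0 L2 ++ Lg d) ⊕ pre (rep 1 L2) (R→D a v a⊥v ⊕ substitute-run 0 1 L2)))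
      where
      collect : ∀ a l m → (a + l) + (m + a) ≡ 2 * a + l + m
      collect = solve-∀
      cost : length (rep 0 L2 ++ Lg d) + (d * L0 + L2) ≡ Es d
      cost = trans (cong (_+ (d * L0 + L2)) (trans (length-run++ 0 L2 (Lg d)) (cong (L2 +_) length-Lg)))
                   (collect L2 (lTot d) (d * L0))

    -- Any pair: 0^{l₂} → 1^{l₂}, L → D, keep 1^{l₂}, delete R 0^{l₂}.
    AG-any : ∀ (a v : Vec Bool d) → EDIT≤ (AG₁ a) (AG₂ v) (Eu d)
    AG-any a v = cast refl (cong (λ t → rep 1 L2 ++ Dg v ++ t) (++-identityʳ (rep 1 L2)))
      (recost cost (substitute-run 0 1 L2 ⊕ L→D v ⊕ pre (rep 1 L2) (delete-all (Rg a ++ rep 0 L2))))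
      where
      collect : ∀ a l m d → a + (d * suc m + (l + a)) ≡ l + 2 * a + d * m + d
      collect = solve-∀
      cost : L2 + (d * suc L0 + length (Rg a ++ rep 0 L2)) ≡ Eu d
      cost = trans (cong (λ t → L2 + (d * suc L0 + t)) (trans (length-++ (Rg a)) (cong₂ _+_ (length-Rg a) (length-replicate L2))))
                   (collect L2 (lTot d) L0 d)

-- Alignment of gadget sequences

pairwise : ∀ {X : Set} {c} (h₁ h₂ : X → Str) → (∀ x y → EDIT≤ (h₁ x) (h₂ y) c) →
           ∀ xs ys → length xs ≡ length ys → EDIT≤ (concat (map h₁ xs)) (concat (map h₂ ys)) (length xs * c)
pairwise h₁ h₂ e []       []       _       = edit-refl
pairwise h₁ h₂ e (x ∷ xs) (y ∷ ys) |xs|≡|ys| = e x y ⊕ pairwise h₁ h₂ e xs ys (suc-injective |xs|≡|ys|)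

record Window {X : Set} (xs : List X) (b : X) (p q : ℕ) : Set where
  field
    left mid₁ mid₂ right : List X
    split       : xs ≡ left ++ (mid₁ ++ b ∷ mid₂) ++ right
    length-mid₁ : length mid₁ ≡ p
    length-mid₂ : length mid₂ ≡ q

window : ∀ {X : Set} (pre post : List X) (b : X) {p q} →
         p ≤ length pre → q ≤ length post → Window (pre ++ b ∷ post) b p q
window pre post b {p} {q} p≤ q≤ = record
  { left        = take m pre
  ; mid₁        = drop m pre
  ; mid₂        = take q post
  ; right       = drop q post
  ; split       = split
  ; length-mid₁ = trans (length-drop m pre) (m∸[m∸n]≡n p≤)
  ; length-mid₂ = trans (length-take q post) (m≤n⇒m⊓n≡m q≤)
  }
  where
  open ≡-Reasoning
  m : ℕ
  m = length pre ∸ p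
  split : pre ++ b ∷ post ≡ take m pre ++ (drop m pre ++ b ∷ take q post) ++ drop q post
  split = begin
    pre ++ b ∷ post
      ≡⟨ cong₂ (λ u v → u ++ b ∷ v) (sym (take++drop≡id m pre)) (sym (take++drop≡id q post)) ⟩
    (take m pre ++ drop m pre) ++ b ∷ (take q post ++ drop q post)
      ≡⟨ ++-assoc (take m pre) (drop m pre) _ ⟩
    take m pre ++ drop m pre ++ b ∷ take q post ++ drop q post
      ≡⟨ cong (take m pre ++_) (sym (++-assoc (drop m pre) (b ∷ take q post) (drop q post))) ⟩
    take m pre ++ (drop m pre ++ b ∷ take q post) ++ drop q post
      ∎

final-cost : ∀ N p q s e d → e ≡ s + d →
             N + ((p * e + (s + q * e)) + N) ≡ (2 * N + (p + suc q) * e) ∸ (e ∸ s)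
final-cost N p q s _ d refl = begin
    N + ((p * (s + d) + (s + q * (s + d))) + N)
      ≡⟨ sym (m+n∸n≡m _ d) ⟩
    (N + ((p * (s + d) + (s + q * (s + d))) + N) + d) ∸ d
      ≡⟨ cong₂ _∸_ (sum-up N p q s d) (sym (m+n∸m≡n s d)) ⟩
    (2 * N + (p + suc q) * (s + d)) ∸ ((s + d) ∸ s)
      ∎
  where
  open ≡-Reasoning
  sum-up : ∀ N p q s d → N + ((p * (s + d) + (s + q * (s + d))) + N) + d ≡ 2 * N + (p + suc q) * (s + d)
  sum-up = solve-∀

-- The reduction

Bound : ∀ d → List (Vec Bool d) → List (Vec Bool d) → Set
Bound d A B = let P = P₂ A B in
  EDIT≤ (rep 3 (length P) ++ P₁ A ++ rep 3 (length P)) P ((2 * length P + length A * Eu d) ∸ (Eu d ∸ Es d))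

module _ (d : ℕ) (1≤d : 1 ≤ d) where
  AGs₁ AGs₂ : List (Vec Bool d) → Str
  AGs₁ xs = concat (map AG₁' xs)
  AGs₂ xs = concat (map AG₂' xs)

  padding : ℕ → List (Vec Bool d)
  padding k = replicate k (fVec d)

  P₂-as-gadgets : ∀ A B → let pad = padding (length A ∸ 1) in P₂ A B ≡ AGs₂ (pad ++ B ++ pad)
  P₂-as-gadgets A B = begin
      P₂ A B
        ≡⟨ cong₂ (λ u v → u ++ AGs₂ B ++ v) pad-gadgets pad-gadgets ⟩
      AGs₂ pad ++ AGs₂ B ++ AGs₂ pad
        ≡⟨ cong (AGs₂ pad ++_) (sym (concat-map-++ AG₂' B pad)) ⟩
      AGs₂ pad ++ AGs₂ (B ++ pad)
        ≡⟨ sym (concat-map-++ AG₂' pad (B ++ pad)) ⟩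
      AGs₂ (pad ++ B ++ pad)
        ∎
    where
    open ≡-Reasoning
    pad : List (Vec Bool d)
    pad = padding (length A ∸ 1)
    pad-gadgets : concat (replicate (length A ∸ 1) (AG₂' (fVec d))) ≡ AGs₂ pad
    pad-gadgets = cong concat (sym (map-replicate AG₂' (length A ∸ 1) (fVec d)))

  -- Edit 3^N P₁(A₁ a A₂) 3^N into a string P of length N whose gadget list has a window
  -- around b shaped like A: the 3-runs absorb the leftovers, a ↦ b, the rest pairwise.
  edit-through-window : ∀ (A₁ A₂ : List (Vec Bool d)) a b → dot a b ≡ 0 →
    ∀ (P : Str) Bs → P ≡ AGs₂ Bs → Window Bs b (length A₁) (length A₂) →
    EDIT≤ (rep 3 (length P) ++ P₁ (A₁ ++ a ∷ A₂) ++ rep 3 (length P)) P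
          (length P + ((length A₁ * Eu d + (Es d + length A₂ * Eu d)) + length P))
  edit-through-window A₁ A₂ a b a⊥b P Bs P≡ w =
    cast refl (sym P-split)
      (shrink-run 3 N (AGs₂ left) left≤N ⊕ matched ⊕ shrink-run 3 N (AGs₂ right) right≤N)
    where
    open Window w
    N : ℕ
    N = length P
    P-split : P ≡ AGs₂ left ++ AGs₂ (mid₁ ++ b ∷ mid₂) ++ AGs₂ right
    P-split = trans P≡ (trans (cong AGs₂ split) (trans (concat-map-++ AG₂' left _)
                (cong (AGs₂ left ++_) (concat-map-++ AG₂' (mid₁ ++ b ∷ mid₂) right))))
    left≤N : length (AGs₂ left) ≤ N
    left≤N = ≤-trans (length-++-≤ˡ (AGs₂ left)) (≤-reflexive (cong length (sym P-split)))
    right≤N : length (AGs₂ right) ≤ N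
    right≤N = ≤-trans (length-++-≤ʳ (AGs₂ right) {AGs₂ (mid₁ ++ b ∷ mid₂)})
               (≤-trans (length-++-≤ʳ _ {AGs₂ left}) (≤-reflexive (cong length (sym P-split))))
    matched : EDIT≤ (P₁ (A₁ ++ a ∷ A₂)) (AGs₂ (mid₁ ++ b ∷ mid₂)) (length A₁ * Eu d + (Es d + length A₂ * Eu d))
    matched = cast (sym (concat-map-++ AG₁' A₁ (a ∷ A₂))) (sym (concat-map-++ AG₂' mid₁ (b ∷ mid₂)))
      (pairwise AG₁' AG₂' any-pair A₁ mid₁ (sym length-mid₁)
       ⊕ padded d a b (AG-orthogonal d 1≤d a b a⊥b)
       ⊕ pairwise AG₁' AG₂' any-pair A₂ mid₂ (sym length-mid₂))
      where
      any-pair : ∀ x y → EDIT≤ (AG₁' x) (AG₂' y) (Eu d)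
      any-pair x y = padded d x y (AG-any d 1≤d x y)

  reduction : ∀ (A₁ A₂ B₁ B₂ : List (Vec Bool d)) a b → dot a b ≡ 0 →
              Bound d (A₁ ++ a ∷ A₂) (B₁ ++ b ∷ B₂)
  reduction A₁ A₂ B₁ B₂ a b a⊥b =
    recost cost (edit-through-window A₁ A₂ a b a⊥b P (pad ++ B ++ pad) (P₂-as-gadgets A B) around-b)
    where
    A B : List (Vec Bool d)
    A = A₁ ++ a ∷ A₂
    B = B₁ ++ b ∷ B₂
    P : Str
    P = P₂ A B
    k : ℕ
    k = length A ∸ 1
    pad : List (Vec Bool d)
    pad = padding k
    k≡ : k ≡ length A₁ + length A₂
    k≡ = cong (_∸ 1) (trans (length-++ A₁) (+-suc (length A₁) (length A₂)))
    |pad|≡k : length pad ≡ k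
    |pad|≡k = length-replicate k
    A₁≤ : length A₁ ≤ length (pad ++ B₁)
    A₁≤ = ≤-trans (m≤m+n (length A₁) (length A₂))
            (≤-trans (≤-reflexive (sym (trans |pad|≡k k≡))) (length-++-≤ˡ pad))
    A₂≤ : length A₂ ≤ length (B₂ ++ pad)
    A₂≤ = ≤-trans (m≤n+m (length A₂) (length A₁))
            (≤-trans (≤-reflexive (sym (trans |pad|≡k k≡))) (length-++-≤ʳ pad {B₂}))
    regroup : (pad ++ B₁) ++ b ∷ (B₂ ++ pad) ≡ pad ++ B ++ pad
    regroup = trans (++-assoc pad B₁ _) (cong (pad ++_) (sym (++-assoc B₁ (b ∷ B₂) pad)))
    around-b : Window (pad ++ B ++ pad) b (length A₁) (length A₂)
    around-b = subst (λ xs → Window xs b _ _) regroup (window (pad ++ B₁) (B₂ ++ pad) b A₁≤ A₂≤)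
    cost : length P + ((length A₁ * Eu d + (Es d + length A₂ * Eu d)) + length P)
           ≡ (2 * length P + length A * Eu d) ∸ (Eu d ∸ Es d)
    cost = trans (final-cost (length P) (length A₁) (length A₂) (Es d) (Eu d) d (Eu≡Es+d d))
                 (cong (λ n → (2 * length P + n * Eu d) ∸ (Eu d ∸ Es d)) (sym (length-++ A₁)))

-- Main theorem: split A and B at the orthogonal pair and apply the reduction.
mainTheorem8 : (d : ℕ) → 1 ≤ d →
    (A B : List (Vec Bool d)) → Unique A → Unique B → A ≢ [] → B ≢ [] →
    length A ≤ length B →
    (∃₂ λ a b → a ∈ A × b ∈ B × dot a b ≡ 0) →
    let P₂' = P₂ A B
        P₁' = rep 3 (length P₂') ++ P₁ A ++ rep 3 (length P₂')
        Y = 2 * length P₂' + length A * Eu d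
    in EDIT≤ P₁' P₂' (Y ∸ (Eu d ∸ Es d))
mainTheorem8 d 1≤d A B _ _ _ _ _ (a , b , a∈A , b∈B , a⊥b) =
  let A₁ , A₂ , A≡ = ∈-∃++ a∈A
      B₁ , B₂ , B≡ = ∈-∃++ b∈B
  in subst₂ (Bound d) (sym A≡) (sym B≡) (reduction d 1≤d A₁ A₂ B₁ B₂ a b a⊥b)
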